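{- Let $\Gamma$ be a finite simple graph whose vertex set is partitioned as $C \cup D$ with $|C| = 4$, and write $C = C_1 \cup C_2$ with $C_1 \cap C_2 = \emptyset$ and $|C_1| = |C_2| = 2$. Assume: (i) the induced subgraphs on $C_1$, on $C_2$ and on $C_1 \cup C_2 = C$ are regular, and the induced subgraphs on $C_1$ and $C_2$ have the same degree; (ii) every $x \in D$ has $0$, $2$ or $4$ neighbours in $C$; (iii) every $x \in D$ either has the same number of neighbours in $C_1$ as in $C_2$, or satisfies $\Gamma(x) \cap C \in \{C_1, C_2\}$. Let $\overline{\Gamma}_1$ be the graph obtained from $\Gamma$ by Godsil–McKay switching: for every $x \in D$ with $|\Gamma(x) \cap C| = 2$, replace adjacency by non-adjacency and vice versa between $x$ and all vertices of $C$ (all other adjacencies unchanged). Let $\overline{\Gamma}_2$ be the graph obtained from $\Gamma$ by Wang–Qiu–Hu switching: for every $x \in D$ with $\Gamma(x) \cap C \in \{C_1, C_2\}$, replace adjacency by non-adjacency and vice versa between $x$ and all vertices of $C_1 \cup C_2$ (all other adjacencies unchanged). Then $\overline{\Gamma}_1$ and $\overline{\Gamma}_2$ are isomorphic.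
   Context: $\Gamma(x)$ denotes the set of neighbours of the vertex $x$ in $\Gamma$. All graphs are finite, simple and undirected. -}

module Defs where

open import Data.Nat using (ℕ; zero; suc; _+_; _≡ᵇ_)
open import Data.Bool using (Bool; true; false; _∧_; _∨_; not; if_then_else_)
open import Data.Fin using (Fin; _≟_)
open import Data.List using (List; []; _∷_; map)
open import Data.Nat.ListAction using (sum)
open import Data.List.Relation.Unary.All using (All)
open import Data.Product using (Σ; ∃; _×_)
open import Function.Bundles using (_↔_; Inverse)
open import Relation.Nullary.Decidable using (⌊_⌋)
open import Relation.Binary.PropositionalEquality using (_≡_; _≢_)

record Graph (n : ℕ) : Set where
  field
    adj    : Fin n → Fin n → Bool
    sym    : ∀ x y → adj x y ≡ adj y x
    irrefl : ∀ x → adj x x ≡ false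

b2n : Bool → ℕ
b2n true  = 1
b2n false = 0

degIn : ∀ {n} → (Fin n → Fin n → Bool) → List (Fin n) → Fin n → ℕ
degIn A S x = sum (map (λ y → b2n (A x y)) S)

-- the subgraph induced on S (S a duplicate-free list) is k-regular
RegularWith : ∀ {n} → (Fin n → Fin n → Bool) → List (Fin n) → ℕ → Set
RegularWith A S k = All (λ v → degIn A S v ≡ k) S

Regular : ∀ {n} → (Fin n → Fin n → Bool) → List (Fin n) → Set
Regular A S = ∃ λ k → RegularWith A S k

mem : ∀ {n} → Fin n → List (Fin n) → Bool
mem x []       = false
mem x (y ∷ ys) = ⌊ x ≟ y ⌋ ∨ mem x ys

-- Γ(x) ∩ C = T, where T ⊆ C (both given as lists, C duplicate-free)
nbrCEq : ∀ {n} → (Fin n → Fin n → Bool) → List (Fin n) → List (Fin n) → Fin n → Bool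
nbrCEq A C T x = allL C
  where
  allL : List _ → Bool
  allL []       = true
  allL (y ∷ ys) = (if mem y T then A x y else not (A x y)) ∧ allL ys

-- Switching of adjacency between the vertices of C and the vertices
-- y satisfying the predicate S (S is only ever true outside C).
switch : ∀ {n} → (Fin n → Fin n → Bool) → List (Fin n) → (Fin n → Bool)
       → Fin n → Fin n → Bool
switch A C S x y =
  if (mem x C ∧ S y) ∨ (mem y C ∧ S x) then not (A x y) else A x y

gmSwitch : ∀ {n} → (Fin n → Fin n → Bool) → List (Fin n) → Fin n → Fin n → Bool
gmSwitch A C = switch A C (λ x → not (mem x C) ∧ (degIn A C x ≡ᵇ 2))

wqhSwitch : ∀ {n} → (Fin n → Fin n → Bool) → List (Fin n) → List (Fin n) → Fin n → Fin n → Bool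
wqhSwitch A C1 C2 = switch A (C1 Data.List.++ C2)
  (λ x → not (mem x (C1 Data.List.++ C2))
       ∧ (nbrCEq A (C1 Data.List.++ C2) C1 x ∨ nbrCEq A (C1 Data.List.++ C2) C2 x))

Isomorphic : ∀ {n} → (Fin n → Fin n → Bool) → (Fin n → Fin n → Bool) → Set
Isomorphic {n} A B =
  Σ (Fin n ↔ Fin n) λ f → ∀ x y → A x y ≡ B (Inverse.to f x) (Inverse.to f y)

-- The isomorphism is the double transposition (a b)(c d), which fixes D pointwise.
-- Neither switching touches edges inside C or inside D.  Inside C, comparing the
-- degrees of a, c and d in the regular graphs Γ[C₁], Γ[C₂] and Γ[C] gives
-- a ∼ c ⇔ b ∼ d and a ∼ d ⇔ b ∼ c, so (a b)(c d) is an automorphism of Γ[C].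
-- A vertex x ∈ D with Γ(x) ∩ C ∈ {∅, C} is switched by neither operation, one with
-- Γ(x) ∩ C ∈ {C₁, C₂} by both, and in either case the swap preserves Γ(x) ∩ C.
-- Every other x ∈ D has exactly one neighbour in each of C₁ and C₂; only the
-- Godsil–McKay switching acts on it, and the swap maps Γ(x) ∩ C onto C ∖ Γ(x).

module Submission where

open import Defs
open import Data.Nat using (ℕ; _+_; _≡ᵇ_)
open import Data.Nat.Properties using (+-identityʳ; +-assoc; +-comm; +-cancelˡ-≡; +-cancelʳ-≡)
open import Data.Bool using (Bool; true; false; not; _∧_; _∨_; _xor_; if_then_else_)
open import Data.Fin using (Fin; _≟_)
open import Data.Fin.Permutation using (Permutation′; _⟨$⟩ʳ_; _∘ₚ_; transpose)
import Data.Fin.Permutation.Components as PC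
open import Data.List using (List; []; _∷_; _++_)
open import Data.List.Membership.Propositional using (_∈_; _∉_)
open import Data.List.Relation.Unary.All using (All; []; _∷_)
open import Data.List.Relation.Unary.Any using (here; there)
open import Data.Product using (∃; _×_; _,_; proj₁; proj₂)
open import Data.Sum using (_⊎_; [_,_]′)
open import Data.Empty using (⊥-elim)
open import Function using (_∘_)
open import Relation.Nullary using (yes; no)
open import Relation.Nullary.Decidable using (dec-true; dec-false)
open import Relation.Nullary.Negation using (contradiction)
open import Relation.Binary.PropositionalEquality
  using (_≡_; _≢_; refl; sym; trans; cong; cong₂; ≢-sym; module ≡-Reasoning)

private
  variable
    n : ℕ

mem⇒∈ : ∀ {x : Fin n} ys → mem x ys ≡ true → x ∈ ys
mem⇒∈ {x = x} (y ∷ ys) h with x ≟ y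
... | yes x≡y = here x≡y
... | no _    = there (mem⇒∈ ys h)

∈⇒mem : ∀ {x : Fin n} {ys} → x ∈ ys → mem x ys ≡ true
∈⇒mem {x = x} (here {x = y} x≡y) with x ≟ y
... | yes _   = refl
... | no x≢y  = contradiction x≡y x≢y
∈⇒mem {x = x} (there {x = y} x∈ys) with x ≟ y
... | yes _ = refl
... | no _  = ∈⇒mem x∈ys

mem-false⇒∉ : ∀ {x : Fin n} {ys} → mem x ys ≡ false → x ∉ ys
mem-false⇒∉ h x∈ys with () ← trans (sym (∈⇒mem x∈ys)) h

All≢⇒mem-false : ∀ {x : Fin n} {ys} → All (x ≢_) ys → mem x ys ≡ false
All≢⇒mem-false []                 = refl
All≢⇒mem-false {x = x} (_∷_ {x = y} x≢y x≢ys) with x ≟ y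
... | yes x≡y = contradiction x≡y x≢y
... | no _    = All≢⇒mem-false x≢ys

transpose-matchˡ : (i j : Fin n) → PC.transpose i j i ≡ j
transpose-matchˡ i j rewrite dec-true (i ≟ i) refl = refl

transpose-matchʳ : (i j : Fin n) → PC.transpose i j j ≡ i
transpose-matchʳ i j with j ≟ i
... | yes j≡i = j≡i
... | no _ rewrite dec-true (j ≟ j) refl = refl

transpose-other : {i j k : Fin n} → k ≢ i → k ≢ j → PC.transpose i j k ≡ k
transpose-other {i = i} {j} {k} k≢i k≢j
  rewrite dec-false (k ≟ i) k≢i | dec-false (k ≟ j) k≢j = refl

switchOutside : (Fin n → Fin n → Bool) → List (Fin n) → (Fin n → Bool) → Fin n → Fin n → Bool
switchOutside A C P = switch A C (λ x → not (mem x C) ∧ P x)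

if-not≡xor : ∀ b v → (if b then not v else v) ≡ b xor v
if-not≡xor true  _ = refl
if-not≡xor false _ = refl

module _ (A : Fin n → Fin n → Bool) (C : List (Fin n)) (P : Fin n → Bool) where

  switchOutside-in-in : ∀ {x y} → mem x C ≡ true → mem y C ≡ true
                      → switchOutside A C P x y ≡ A x y
  switchOutside-in-in mx my rewrite mx | my = refl

  switchOutside-out-out : ∀ {x y} → mem x C ≡ false → mem y C ≡ false
                        → switchOutside A C P x y ≡ A x y
  switchOutside-out-out mx my rewrite mx | my = refl

  switchOutside-out-in : ∀ {x y} → mem x C ≡ false → mem y C ≡ true
                       → switchOutside A C P x y ≡ P x xor A x y
  switchOutside-out-in {x} {y} mx my rewrite mx | my = if-not≡xor (P x) (A x y)

  switchOutside-in-out : ∀ {x y} → mem x C ≡ true → mem y C ≡ false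
                       → switchOutside A C P x y ≡ P y xor A x y
  switchOutside-in-out {x} {y} mx my rewrite mx | my with P y
  ... | true  = refl
  ... | false = refl

switchOutside-isomorphic :
    (Γ : Graph n) (C : List (Fin n)) (P Q : Fin n → Bool) (π : Permutation′ n)
  → (∀ {x} → x ∈ C → π ⟨$⟩ʳ x ∈ C)
  → (∀ {x} → mem x C ≡ false → π ⟨$⟩ʳ x ≡ x)
  → (∀ {x y} → x ∈ C → y ∈ C → Graph.adj Γ x y ≡ Graph.adj Γ (π ⟨$⟩ʳ x) (π ⟨$⟩ʳ y))
  → (∀ {x y} → mem x C ≡ false → y ∈ C
       → P x xor Graph.adj Γ x y ≡ Q x xor Graph.adj Γ x (π ⟨$⟩ʳ y))
  → Isomorphic (switchOutside (Graph.adj Γ) C P) (switchOutside (Graph.adj Γ) C Q)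
switchOutside-isomorphic {n} Γ C P Q π maps-inside fixes-outside preserves-inside flags-correspond =
  π , λ x y → edge x y refl refl
  where
  open Graph Γ using (adj) renaming (sym to adj-sym)
  open ≡-Reasoning

  σ : Fin n → Fin n
  σ = π ⟨$⟩ʳ_

  σ-mem-true : ∀ {x} → mem x C ≡ true → mem (σ x) C ≡ true
  σ-mem-true = ∈⇒mem ∘ maps-inside ∘ mem⇒∈ C

  σ-mem-false : ∀ {x} → mem x C ≡ false → mem (σ x) C ≡ false
  σ-mem-false mx = trans (cong (λ z → mem z C) (fixes-outside mx)) mx

  edge : ∀ x y {s t} → mem x C ≡ s → mem y C ≡ t
                → switchOutside adj C P x y ≡ switchOutside adj C Q (σ x) (σ y)
  edge x y {true} {true} mx my = begin
    switchOutside adj C P x y          ≡⟨ switchOutside-in-in adj C P mx my ⟩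
    adj x y                            ≡⟨ preserves-inside (mem⇒∈ C mx) (mem⇒∈ C my) ⟩
    adj (σ x) (σ y)                    ≡⟨ switchOutside-in-in adj C Q (σ-mem-true mx) (σ-mem-true my) ⟨
    switchOutside adj C Q (σ x) (σ y)  ∎
  edge x y {false} {false} mx my = begin
    switchOutside adj C P x y          ≡⟨ switchOutside-out-out adj C P mx my ⟩
    adj x y                            ≡⟨ cong₂ adj (fixes-outside mx) (fixes-outside my) ⟨
    adj (σ x) (σ y)                    ≡⟨ switchOutside-out-out adj C Q (σ-mem-false mx) (σ-mem-false my) ⟨
    switchOutside adj C Q (σ x) (σ y)  ∎
  edge x y {false} {true} mx my = begin
    switchOutside adj C P x y          ≡⟨ switchOutside-out-in adj C P mx my ⟩
    P x xor adj x y                    ≡⟨ flags-correspond mx (mem⇒∈ C my) ⟩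
    Q x xor adj x (σ y)                ≡⟨ cong (λ z → Q z xor adj z (σ y)) (fixes-outside mx) ⟨
    Q (σ x) xor adj (σ x) (σ y)        ≡⟨ switchOutside-out-in adj C Q (σ-mem-false mx) (σ-mem-true my) ⟨
    switchOutside adj C Q (σ x) (σ y)  ∎
  edge x y {true} {false} mx my = begin
    switchOutside adj C P x y          ≡⟨ switchOutside-in-out adj C P mx my ⟩
    P y xor adj x y                    ≡⟨ cong (P y xor_) (adj-sym x y) ⟩
    P y xor adj y x                    ≡⟨ flags-correspond my (mem⇒∈ C mx) ⟩
    Q y xor adj y (σ x)                ≡⟨ cong (Q y xor_) (adj-sym y (σ x)) ⟩
    Q y xor adj (σ x) y                ≡⟨ cong (λ z → Q z xor adj (σ x) z) (fixes-outside my) ⟨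
    Q (σ y) xor adj (σ x) (σ y)        ≡⟨ switchOutside-in-out adj C Q (σ-mem-true mx) (σ-mem-false my) ⟨
    switchOutside adj C Q (σ x) (σ y)  ∎

b2n-injective : ∀ {p q} → b2n p ≡ b2n q → p ≡ q
b2n-injective {true}  {true}  _ = refl
b2n-injective {false} {false} _ = refl

+-rotate : ∀ x y z → x + (y + (z + 0)) ≡ z + (x + y)
+-rotate x y z = begin
  x + (y + (z + 0))  ≡⟨ cong (λ t → x + (y + t)) (+-identityʳ z) ⟩
  x + (y + z)        ≡⟨ +-assoc x y z ⟨
  x + y + z          ≡⟨ +-comm (x + y) z ⟩
  z + (x + y)        ∎
  where open ≡-Reasoning

module _ (Γ : Graph n) where
  open Graph Γ using (adj) renaming (sym to adj-sym; irrefl to adj-irrefl)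

  private
    e : Fin n → Fin n → ℕ
    e x y = b2n (adj x y)

  degIn-pair : ∀ x y → degIn adj (x ∷ y ∷ []) x ≡ e x y
  degIn-pair x y rewrite adj-irrefl x = +-identityʳ (e x y)

  module _ (a b c d : Fin n) where
    private
      deg : Fin n → ℕ
      deg = degIn adj (a ∷ b ∷ c ∷ d ∷ [])

    degIn-square-a : deg a ≡ e a b + (e a c + e a d)
    degIn-square-a rewrite adj-irrefl a = cong (λ t → e a b + (e a c + t)) (+-identityʳ (e a d))

    degIn-square-c : deg c ≡ e c d + (e a c + e b c)
    degIn-square-c rewrite adj-irrefl c | adj-sym c a | adj-sym c b = +-rotate (e a c) (e b c) (e c d)

    degIn-square-d : deg d ≡ e c d + (e a d + e b d)
    degIn-square-d rewrite adj-irrefl d | adj-sym d a | adj-sym d b | adj-sym d c =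
      +-rotate (e a d) (e b d) (e c d)

    regular-square-cross-edges : ∀ {k r}
      → RegularWith adj (a ∷ b ∷ []) k → RegularWith adj (c ∷ d ∷ []) k
      → RegularWith adj (a ∷ b ∷ c ∷ d ∷ []) r
      → adj a c ≡ adj b d × adj a d ≡ adj b c
    regular-square-cross-edges {r = r} (ka ∷ _) (kc ∷ _) (ra ∷ _ ∷ rc ∷ rd ∷ []) =
      b2n-injective (+-cancelʳ-≡ (e a d) (e a c) (e b d) (trans a≈d (+-comm (e a d) (e b d)))) ,
      b2n-injective (+-cancelˡ-≡ (e a c) (e a d) (e b c) a≈c)
      where
      ab≡cd : e a b ≡ e c d
      ab≡cd = trans (sym (degIn-pair a b)) (trans ka (trans (sym kc) (degIn-pair c d)))

      same-cross-degree : ∀ {z u v} → deg z ≡ r → deg z ≡ e c d + (u + v)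
                        → e a c + e a d ≡ u + v
      same-cross-degree {z} {u} {v} rz deg-z = +-cancelˡ-≡ (e c d) _ _ (begin
        e c d + (e a c + e a d)  ≡⟨ cong (_+ _) ab≡cd ⟨
        e a b + (e a c + e a d)  ≡⟨ degIn-square-a ⟨
        deg a                    ≡⟨ trans ra (sym rz) ⟩
        deg z                    ≡⟨ deg-z ⟩
        e c d + (u + v)          ∎)
        where open ≡-Reasoning

      a≈c : e a c + e a d ≡ e a c + e b c
      a≈c = same-cross-degree {u = e a c} {v = e b c} rc degIn-square-c

      a≈d : e a c + e a d ≡ e a d + e b d
      a≈d = same-cross-degree {u = e a d} {v = e b d} rd degIn-square-d

-- gm and wqh are the flags of gmSwitch and wqhSwitch, unfolded for a vertex outside C
-- whose adjacencies to a, b, c, d are p, q, r, s.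
switched-rows-correspond : ∀ p q r s →
  let m   = b2n p + (b2n q + (b2n r + (b2n s + 0)))
      gm  = m ≡ᵇ 2
      wqh = (p ∧ (q ∧ (not r ∧ (not s ∧ true)))) ∨ (not p ∧ (not q ∧ (r ∧ (s ∧ true))))
  in m ≡ 0 ⊎ m ≡ 2 ⊎ m ≡ 4
   → (gm xor p ≡ wqh xor q) × (gm xor q ≡ wqh xor p) × (gm xor r ≡ wqh xor s) × (gm xor s ≡ wqh xor r)
switched-rows-correspond false false false false _ = refl , refl , refl , refl
switched-rows-correspond true  true  false false _ = refl , refl , refl , refl
switched-rows-correspond false false true  true  _ = refl , refl , refl , refl
switched-rows-correspond true  false true  false _ = refl , refl , refl , refl
switched-rows-correspond true  false false true  _ = refl , refl , refl , refl
switched-rows-correspond false true  true  false _ = refl , refl , refl , refl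
switched-rows-correspond false true  false true  _ = refl , refl , refl , refl
switched-rows-correspond true  true  true  true  _ = refl , refl , refl , refl
switched-rows-correspond true  false false false h = ⊥-elim ([ (λ ()) , [ (λ ()) , (λ ()) ]′ ]′ h)
switched-rows-correspond false true  false false h = ⊥-elim ([ (λ ()) , [ (λ ()) , (λ ()) ]′ ]′ h)
switched-rows-correspond false false true  false h = ⊥-elim ([ (λ ()) , [ (λ ()) , (λ ()) ]′ ]′ h)
switched-rows-correspond false false false true  h = ⊥-elim ([ (λ ()) , [ (λ ()) , (λ ()) ]′ ]′ h)
switched-rows-correspond false true  true  true  h = ⊥-elim ([ (λ ()) , [ (λ ()) , (λ ()) ]′ ]′ h)
switched-rows-correspond true  false true  true  h = ⊥-elim ([ (λ ()) , [ (λ ()) , (λ ()) ]′ ]′ h)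
switched-rows-correspond true  true  false true  h = ⊥-elim ([ (λ ()) , [ (λ ()) , (λ ()) ]′ ]′ h)
switched-rows-correspond true  true  true  false h = ⊥-elim ([ (λ ()) , [ (λ ()) , (λ ()) ]′ ]′ h)

pattern 1st = here refl
pattern 2nd = there (here refl)
pattern 3rd = there (there (here refl))
pattern 4th = there (there (there (here refl)))

module DoubleTransposition {n} (a b c d : Fin n)
  (a≢c : a ≢ c) (a≢d : a ≢ d) (b≢c : b ≢ c) (b≢d : b ≢ d) where

  C₁ C₂ C : List (Fin n)
  C₁ = a ∷ b ∷ []
  C₂ = c ∷ d ∷ []
  C  = C₁ ++ C₂

  π : Permutation′ n
  π = transpose a b ∘ₚ transpose c d

  σ : Fin n → Fin n
  σ = π ⟨$⟩ʳ_

  σa : σ a ≡ b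
  σa = trans (cong (PC.transpose c d) (transpose-matchˡ a b)) (transpose-other b≢c b≢d)

  σb : σ b ≡ a
  σb = trans (cong (PC.transpose c d) (transpose-matchʳ a b)) (transpose-other a≢c a≢d)

  σc : σ c ≡ d
  σc = trans (cong (PC.transpose c d) (transpose-other (≢-sym a≢c) (≢-sym b≢c))) (transpose-matchˡ c d)

  σd : σ d ≡ c
  σd = trans (cong (PC.transpose c d) (transpose-other (≢-sym a≢d) (≢-sym b≢d))) (transpose-matchʳ c d)

  maps-inside : ∀ {x} → x ∈ C → σ x ∈ C
  maps-inside 1st = there (here σa)
  maps-inside 2nd = here σb
  maps-inside 3rd = there (there (there (here σc)))
  maps-inside 4th = there (there (here σd))

  fixes-outside : ∀ {x} → mem x C ≡ false → σ x ≡ x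
  fixes-outside mx = trans
    (cong (PC.transpose c d) (transpose-other (x∉C ∘ here) (x∉C ∘ there ∘ here)))
    (transpose-other (x∉C ∘ there ∘ there ∘ here) (x∉C ∘ there ∘ there ∘ there ∘ here))
    where
    x∉C : _ ∉ C
    x∉C = mem-false⇒∉ mx

  module _ (Γ : Graph n) where
    open Graph Γ using (adj) renaming (sym to adj-sym; irrefl to adj-irrefl)

    module _ (ac≡bd : adj a c ≡ adj b d) (ad≡bc : adj a d ≡ adj b c) where
      private
        loops : ∀ x y → adj x x ≡ adj y y
        loops x y = trans (adj-irrefl x) (sym (adj-irrefl y))

        along : ∀ {x y x′ y′} → σ x ≡ x′ → σ y ≡ y′ → adj x y ≡ adj x′ y′
              → adj x y ≡ adj (σ x) (σ y)
        along σx σy e = trans e (sym (cong₂ adj σx σy))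

      preserves-edges-inside : ∀ {x y} → x ∈ C → y ∈ C → adj x y ≡ adj (σ x) (σ y)
      preserves-edges-inside 1st 1st = along σa σa (loops a b)
      preserves-edges-inside 1st 2nd = along σa σb (adj-sym a b)
      preserves-edges-inside 1st 3rd = along σa σc ac≡bd
      preserves-edges-inside 1st 4th = along σa σd ad≡bc
      preserves-edges-inside 2nd 1st = along σb σa (adj-sym b a)
      preserves-edges-inside 2nd 2nd = along σb σb (loops b a)
      preserves-edges-inside 2nd 3rd = along σb σc (sym ad≡bc)
      preserves-edges-inside 2nd 4th = along σb σd (sym ac≡bd)
      preserves-edges-inside 3rd 1st = along σc σa (trans (adj-sym c a) (trans ac≡bd (adj-sym b d)))
      preserves-edges-inside 3rd 2nd = along σc σb (trans (adj-sym c b) (trans (sym ad≡bc) (adj-sym a d)))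
      preserves-edges-inside 3rd 3rd = along σc σc (loops c d)
      preserves-edges-inside 3rd 4th = along σc σd (adj-sym c d)
      preserves-edges-inside 4th 1st = along σd σa (trans (adj-sym d a) (trans ad≡bc (adj-sym b c)))
      preserves-edges-inside 4th 2nd = along σd σb (trans (adj-sym d b) (trans (sym ac≡bd) (adj-sym a c)))
      preserves-edges-inside 4th 3rd = along σd σc (adj-sym d c)
      preserves-edges-inside 4th 4th = along σd σd (loops d c)

    wqh-flag-unfold : ∀ x → nbrCEq adj C C₁ x ∨ nbrCEq adj C C₂ x
                    ≡ (adj x a ∧ (adj x b ∧ (not (adj x c) ∧ (not (adj x d) ∧ true))))
                      ∨ (not (adj x a) ∧ (not (adj x b) ∧ (adj x c ∧ (adj x d ∧ true))))
    wqh-flag-unfold x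
      rewrite ∈⇒mem {ys = C₁} 1st | ∈⇒mem {ys = C₁} 2nd | ∈⇒mem {ys = C₂} 1st | ∈⇒mem {ys = C₂} 2nd
            | All≢⇒mem-false {ys = C₁} (≢-sym a≢c ∷ ≢-sym b≢c ∷ [])
            | All≢⇒mem-false {ys = C₁} (≢-sym a≢d ∷ ≢-sym b≢d ∷ [])
            | All≢⇒mem-false {ys = C₂} (a≢c ∷ a≢d ∷ [])
            | All≢⇒mem-false {ys = C₂} (b≢c ∷ b≢d ∷ []) = refl

    flags-correspond :
        (∀ x → mem x C ≡ false → degIn adj C x ≡ 0 ⊎ degIn adj C x ≡ 2 ⊎ degIn adj C x ≡ 4)
      → ∀ {x y} → mem x C ≡ false → y ∈ C
      → (degIn adj C x ≡ᵇ 2) xor adj x y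
        ≡ (nbrCEq adj C C₁ x ∨ nbrCEq adj C C₂ x) xor adj x (σ y)
    flags-correspond even-degree {x} mx y∈C rewrite wqh-flag-unfold x
      with switched-rows-correspond (adj x a) (adj x b) (adj x c) (adj x d) (even-degree x mx) | y∈C
    ... | at-a , _ , _ , _ | 1st rewrite σa = at-a
    ... | _ , at-b , _ , _ | 2nd rewrite σb = at-b
    ... | _ , _ , at-c , _ | 3rd rewrite σc = at-c
    ... | _ , _ , _ , at-d | 4th rewrite σd = at-d

lemma3 : ∀ {n} (Γ : Graph n) (a b c d : Fin n)
    → a ≢ b → a ≢ c → a ≢ d → b ≢ c → b ≢ d → c ≢ d
    → ∃ (λ k → RegularWith (Graph.adj Γ) (a ∷ b ∷ []) k
               × RegularWith (Graph.adj Γ) (c ∷ d ∷ []) k)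
    → Regular (Graph.adj Γ) (a ∷ b ∷ c ∷ d ∷ [])
    → (∀ x → mem x (a ∷ b ∷ c ∷ d ∷ []) ≡ false
         → degIn (Graph.adj Γ) (a ∷ b ∷ c ∷ d ∷ []) x ≡ 0
           ⊎ degIn (Graph.adj Γ) (a ∷ b ∷ c ∷ d ∷ []) x ≡ 2
           ⊎ degIn (Graph.adj Γ) (a ∷ b ∷ c ∷ d ∷ []) x ≡ 4)
    → (∀ x → mem x (a ∷ b ∷ c ∷ d ∷ []) ≡ false
         → degIn (Graph.adj Γ) (a ∷ b ∷ []) x ≡ degIn (Graph.adj Γ) (c ∷ d ∷ []) x
           ⊎ nbrCEq (Graph.adj Γ) (a ∷ b ∷ c ∷ d ∷ []) (a ∷ b ∷ []) x ≡ true
           ⊎ nbrCEq (Graph.adj Γ) (a ∷ b ∷ c ∷ d ∷ []) (c ∷ d ∷ []) x ≡ true)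
    → Isomorphic (gmSwitch (Graph.adj Γ) (a ∷ b ∷ c ∷ d ∷ []))
                 (wqhSwitch (Graph.adj Γ) (a ∷ b ∷ []) (c ∷ d ∷ []))
lemma3 Γ a b c d _ a≢c a≢d b≢c b≢d _ (_ , C₁-regular , C₂-regular) (_ , C-regular) even-degree _ =
  switchOutside-isomorphic Γ C
    (λ x → degIn adj C x ≡ᵇ 2) (λ x → nbrCEq adj C C₁ x ∨ nbrCEq adj C C₂ x)
    π maps-inside fixes-outside
    (preserves-edges-inside Γ (proj₁ cross-edges) (proj₂ cross-edges))
    (flags-correspond Γ even-degree)
  where
  open Graph Γ using (adj)
  open DoubleTransposition a b c d a≢c a≢d b≢c b≢d

  cross-edges : adj a c ≡ adj b d × adj a d ≡ adj b c
  cross-edges = regular-square-cross-edges Γ a b c d C₁-regular C₂-regular C-regular
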